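{- Let $M=p_1^{n_1}\cdots p_K^{n_K}$ with distinct primes $p_\nu$ and $n_\nu\in\mathbb{N}$, and $R=\{r\in\mathbb{Z}_M:\gcd(r,M)=1\}$. For $\nu=1,\dots,K$ let $x_\nu,x'_\nu\in\mathbb{Z}_M$ with $\gcd(x_\nu,M)=\gcd(x'_\nu,M)=M/p_\nu^{\alpha_\nu}$, where $\alpha_1,\dots,\alpha_K\ge1$. Then there exists $r\in R$ such that $rx_\nu=x'_\nu$ for all $\nu=1,\dots,K$. -}

module Defs where

open import Data.Nat using (ℕ; zero; suc; _*_)
open import Data.Fin using (Fin; zero; suc)

prodFin : (K : ℕ) → (Fin K → ℕ) → ℕ
prodFin zero    f = 1
prodFin (suc K) f = f zero * prodFin K (λ i → f (suc i))

modulus : (K : ℕ) → (Fin K → ℕ) → (Fin K → ℕ) → ℕ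
modulus K p n = prodFin K (λ ν → p ν Data.Nat.^ n ν)

{-# OPTIONS --safe #-}

-- Write x ν = u ν * g with g = gcd (x ν) M; then M = g * p ν ^ α ν, the cofactor u ν is a
-- unit modulo p ν ^ α ν, and the same g serves x′ ν = u′ ν * g.  The prime powers p ν ^ α ν
-- are pairwise coprime, so the Chinese remainder theorem gives r with r * u ν ≡ u′ ν modulo
-- each of them; multiplying by g turns this into r * x ν ≡ x′ ν modulo M.  Reducing r modulo
-- M keeps these congruences, and r is prime to each p ν because r * u ν is a unit modulo
-- p ν ^ α ν, hence r is prime to M.

module Submission where

open import Defs
open import Data.Nat using (ℕ; _*_; _^_; _<_; _≥_; _+_)
open import Data.Nat.GCD using (gcd)
open import Data.Nat.Primality using (Prime)
open import Data.Fin using (Fin)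
open import Data.Product using (Σ; _×_)
open import Relation.Binary.PropositionalEquality using (_≡_)

open import Data.Nat using (zero; suc; NonZero; nonTrivial⇒≢1)
open import Data.Nat.Properties using (m^n≢0; m*n≢0; m*n≢0⇒m≢0; *-comm; *-assoc; *-identityˡ; *-identityʳ; *-cancelʳ-≡)
open import Data.Nat.DivMod using (_%_; _/_; m≡m%n+[m/n]*n; m%n<n; m<n⇒m%n≡m; m%n%n≡m%n; %-distribˡ-*; %-remove-+ˡ; %-remove-+ʳ; m∣n⇒o%n%m≡o%m; m%n*o≡m*o%[n*o]; [m+kn]%n≡m%n)
open import Data.Nat.Divisibility using (_∣_; divides; ∣-trans; ∣1⇒≡1; n∣m*n; m∣m*n; ∣m⇒∣m*n; ∣n⇒∣m*n; %-presˡ-∣; ∣n∣m%n⇒∣m)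
open import Data.Nat.GCD using (GCD; gcd[m,n]∣m; gcd-GCD; GCD-*; module Bézout)
open import Data.Nat.Coprimality as Coprimality using (Coprime; coprime-Bézout; coprime-divisor; GCD≡1⇒coprime; coprime⇒gcd≡1)
open import Data.Nat.Primality using (prime⇒irreducible; prime⇒nonZero; prime⇒nonTrivial)
open import Data.Nat.Solver using (module +-*-Solver)
open +-*-Solver using (solve; _:=_; _:+_; _:*_; con)
open import Data.Fin using (zero; suc)
open import Data.Fin.Properties using (suc-injective)
open import Data.Product using (∃; _,_; proj₁; proj₂)
open import Data.Sum using (inj₁; inj₂; [_,_])
open import Function using (_∘_; it)
open import Relation.Nullary using (¬_; contradiction)
open import Relation.Binary.PropositionalEquality using (refl; sym; trans; cong; subst; subst₂; _≢_; module ≡-Reasoning)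

private variable
  a b c d m n p q : ℕ

infix 4 _≡_mod_

_≡_mod_ : ℕ → ℕ → (m : ℕ) → .{{NonZero m}} → Set
a ≡ b mod m = a % m ≡ b % m

module _ .{{_ : NonZero m}} where

  ≡mod-*-congˡ : ∀ c → a ≡ b mod m → c * a ≡ c * b mod m
  ≡mod-*-congˡ {a} {b} c a≡b = trans (%-distribˡ-* c a m)
    (trans (cong (λ t → (c % m * t) % m) a≡b) (sym (%-distribˡ-* c b m)))

  ≡mod-*-congʳ : ∀ c → a ≡ b mod m → a * c ≡ b * c mod m
  ≡mod-*-congʳ {a} {b} c a≡b = trans (%-distribˡ-* a c m)
    (trans (cong (λ t → (t * (c % m)) % m) a≡b) (sym (%-distribˡ-* b c m)))

  ≡mod-*-unit : ∀ a → c ≡ 1 mod m → a * c ≡ a mod m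
  ≡mod-*-unit a c≡1 = trans (≡mod-*-congˡ a c≡1) (cong (_% m) (*-identityʳ a))

  %-≡mod : ∀ a → a % m ≡ a mod m
  %-≡mod a = m%n%n≡m%n a m

  ≡mod-reduce : .{{_ : NonZero d}} → d ∣ m → a ≡ b mod m → a ≡ b mod d
  ≡mod-reduce {d} {a} {b} d∣m a≡b = trans (sym (m∣n⇒o%n%m≡o%m d m a d∣m))
    (trans (cong (_% d) a≡b) (m∣n⇒o%n%m≡o%m d m b d∣m))

  ≡mod-∣ : d ∣ m → a ≡ b mod m → d ∣ a → d ∣ b
  ≡mod-∣ d∣m a≡b d∣a = ∣n∣m%n⇒∣m d∣m (subst (_ ∣_) a≡b (%-presˡ-∣ d∣a d∣m))

  ≡mod⇒∃quotient : a ≡ b mod m → b < m → ∃ λ q → a ≡ b + q * m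
  ≡mod⇒∃quotient {a} {b} a≡b b<m =
    a / m , trans (m≡m%n+[m/n]*n a m) (cong (_+ a / m * m) (trans a≡b (m<n⇒m%n≡m b<m)))

  coprime-factor : a * b ≡ c mod m → Coprime c m → Coprime a m
  coprime-factor {a} {b} ab≡c c⊥m (d∣a , d∣m) = c⊥m (≡mod-∣ d∣m ab≡c (∣m⇒∣m*n b d∣a) , d∣m)

≡mod-*-scale : ∀ g .{{_ : NonZero m}} .{{_ : NonZero d}} →
               m ≡ d * g → a ≡ b mod d → a * g ≡ b * g mod m
≡mod-*-scale {d = d} {a} {b} g refl a≡b =
  trans (sym (m%n*o≡m*o%[n*o] a d g)) (trans (cong (_* g) a≡b) (m%n*o≡m*o%[n*o] b d g))

coprime⇒inverse : .{{_ : NonZero m}} → Coprime a m → ∃ λ s → s * a ≡ 1 mod m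
coprime⇒inverse {m} {a} a⊥m with coprime-Bézout a⊥m
... | Bézout.+- x y 1+ym≡xa = x , trans (cong (_% m) (sym 1+ym≡xa)) ([m+kn]%n≡m%n 1 y m)
-- Here x * a ≡ -1, so x * (m - 1) inverts a.
coprime⇒inverse {m@(suc k)} {a} a⊥m | Bézout.-+ x y 1+xa≡ym = x * k , (begin
  x * k * a % m            ≡⟨ [m+kn]%n≡m%n (x * k * a) 1 m ⟨
  (x * k * a + 1 * m) % m  ≡⟨ cong (_% m) shift ⟩
  (1 + k * y * m) % m      ≡⟨ [m+kn]%n≡m%n 1 (k * y) m ⟩
  1 % m                    ∎)
  where
  open ≡-Reasoning
  shift : x * k * a + 1 * m ≡ 1 + k * y * m
  shift = begin
    x * k * a + 1 * m    ≡⟨ solve 3 (λ x k a → x :* k :* a :+ con 1 :* (con 1 :+ k)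
                                          := k :* (con 1 :+ x :* a) :+ con 1) refl x k a ⟩
    k * (1 + x * a) + 1  ≡⟨ cong (λ t → k * t + 1) 1+xa≡ym ⟩
    k * (y * m) + 1      ≡⟨ solve 3 (λ k y m → k :* (y :* m) :+ con 1
                                          := con 1 :+ k :* y :* m) refl k y m ⟩
    1 + k * y * m        ∎

coprime⇒solvable : .{{_ : NonZero m}} → Coprime a m → ∀ b → ∃ λ c → c * a ≡ b mod m
coprime⇒solvable {m} {a} a⊥m b with s , s*a≡1 ← coprime⇒inverse a⊥m =
  b * s , trans (cong (_% m) (*-assoc b s a)) (≡mod-*-unit b s*a≡1)

crt₂ : .{{_ : NonZero m}} .{{_ : NonZero n}} → Coprime m n →
       ∀ a b → ∃ λ r → r ≡ a mod m × r ≡ b mod n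
crt₂ {m} {n} m⊥n a b
  with s , s*n≡1 ← coprime⇒inverse (Coprimality.sym m⊥n)
     | t , t*m≡1 ← coprime⇒inverse m⊥n
  = a * (s * n) + b * (t * m)
  , trans (%-remove-+ʳ (a * (s * n)) (∣n⇒∣m*n b (n∣m*n t))) (≡mod-*-unit a s*n≡1)
  , trans (%-remove-+ˡ (b * (t * m)) (∣n⇒∣m*n a (n∣m*n s))) (≡mod-*-unit b t*m≡1)

coprime-1ʳ : Coprime a 1
coprime-1ʳ (_ , d∣1) = ∣1⇒≡1 d∣1

coprime-∣ˡ : Coprime a m → d ∣ a → Coprime d m
coprime-∣ˡ a⊥m d∣a (i∣d , i∣m) = a⊥m (∣-trans i∣d d∣a , i∣m)

coprime-∣ʳ : Coprime a m → d ∣ m → Coprime a d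
coprime-∣ʳ a⊥m d∣m (i∣a , i∣d) = a⊥m (i∣a , ∣-trans i∣d d∣m)

coprime-*ʳ : Coprime a m → Coprime a n → Coprime a (m * n)
coprime-*ʳ a⊥m a⊥n (d∣a , d∣mn) = a⊥n (d∣a , coprime-divisor (coprime-∣ˡ a⊥m d∣a) d∣mn)

coprime-^ʳ : Coprime a m → ∀ k → Coprime a (m ^ k)
coprime-^ʳ a⊥m zero    = coprime-1ʳ
coprime-^ʳ a⊥m (suc k) = coprime-*ʳ a⊥m (coprime-^ʳ a⊥m k)

coprime-^ : Coprime a b → ∀ i j → Coprime (a ^ i) (b ^ j)
coprime-^ a⊥b i j = Coprimality.sym (coprime-^ʳ (Coprimality.sym (coprime-^ʳ a⊥b j)) i)

prime∤⇒coprime : Prime p → ¬ p ∣ n → Coprime p n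
prime∤⇒coprime p-prime p∤n (d∣p , d∣n) with prime⇒irreducible p-prime d∣p
... | inj₁ d≡1 = d≡1
... | inj₂ refl = contradiction d∣n p∤n

distinct-primes⇒coprime : Prime p → Prime q → p ≢ q → Coprime p q
distinct-primes⇒coprime p-prime q-prime p≢q = prime∤⇒coprime p-prime λ p∣q →
  [ nonTrivial⇒≢1 {{prime⇒nonTrivial p-prime}} , p≢q ] (prime⇒irreducible q-prime p∣q)

prime-powers-coprime : ∀ {K} (p α : Fin K → ℕ) → (∀ ν → Prime (p ν)) →
                       (∀ ν μ → p ν ≡ p μ → ν ≡ μ) →
                       ∀ ν μ → ν ≢ μ → Coprime (p ν ^ α ν) (p μ ^ α μ)
prime-powers-coprime p α prime distinct ν μ ν≢μ =
  coprime-^ (distinct-primes⇒coprime (prime ν) (prime μ) (ν≢μ ∘ distinct ν μ)) (α ν) (α μ)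

m∣m^n : n ≥ 1 → m ∣ m ^ n
m∣m^n {suc n} _ = m∣m*n _

prodFin-nonZero : ∀ K (f : Fin K → ℕ) {{_ : ∀ {ν} → NonZero (f ν)}} → NonZero (prodFin K f)
prodFin-nonZero zero    f = _
prodFin-nonZero (suc K) f = m*n≢0 (f zero) (prodFin K (f ∘ suc)) {{it}} {{prodFin-nonZero K (f ∘ suc)}}

∣prodFin : ∀ K (f : Fin K → ℕ) ν → f ν ∣ prodFin K f
∣prodFin (suc K) f zero    = m∣m*n _
∣prodFin (suc K) f (suc ν) = ∣n⇒∣m*n (f zero) (∣prodFin K (f ∘ suc) ν)

coprime-prodFin : ∀ K (f : Fin K → ℕ) → (∀ ν → Coprime a (f ν)) → Coprime a (prodFin K f)
coprime-prodFin zero    f a⊥f = coprime-1ʳ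
coprime-prodFin (suc K) f a⊥f = coprime-*ʳ (a⊥f zero) (coprime-prodFin K (f ∘ suc) (a⊥f ∘ suc))

modulus-nonZero : ∀ K (p n : Fin K → ℕ) → (∀ ν → Prime (p ν)) → NonZero (modulus K p n)
modulus-nonZero K p n prime =
  prodFin-nonZero K _ {{λ {ν} → m^n≢0 (p ν) (n ν) {{prime⇒nonZero (prime ν)}}}}

coprime-modulus : ∀ K (p n : Fin K → ℕ) → (∀ ν → Coprime a (p ν)) → Coprime a (modulus K p n)
coprime-modulus K p n a⊥p = coprime-prodFin K _ λ ν → coprime-^ʳ (a⊥p ν) (n ν)

crt : ∀ K (m : Fin K → ℕ) {{_ : ∀ {ν} → NonZero (m ν)}} →
      (∀ ν μ → ν ≢ μ → Coprime (m ν) (m μ)) →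
      (a : Fin K → ℕ) → ∃ λ r → ∀ ν → r ≡ a ν mod m ν
crt zero    m m-coprime a = 0 , λ ()
crt (suc K) m m-coprime a =
  let r′ , r′≡a = crt K (m ∘ suc) (λ ν μ ν≢μ → m-coprime (suc ν) (suc μ) (ν≢μ ∘ suc-injective)) (a ∘ suc)
      r , r≡a₀ , r≡r′ = crt₂ head⊥tail (a zero) r′
  in r , λ { zero → r≡a₀ ; (suc ν) → trans (≡mod-reduce (∣prodFin K (m ∘ suc) ν) r≡r′) (r′≡a ν) }
  where
  instance
    tail≢0 : NonZero (prodFin K (m ∘ suc))
    tail≢0 = prodFin-nonZero K (m ∘ suc)
  head⊥tail : Coprime (m zero) (prodFin K (m ∘ suc))
  head⊥tail = coprime-prodFin K (m ∘ suc) λ ν → m-coprime zero (suc ν) λ ()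

crt-linear : ∀ K (m : Fin K → ℕ) {{_ : ∀ {ν} → NonZero (m ν)}} →
             (∀ ν μ → ν ≢ μ → Coprime (m ν) (m μ)) →
             (a : Fin K → ℕ) → (∀ ν → Coprime (a ν) (m ν)) →
             (b : Fin K → ℕ) → ∃ λ r → ∀ ν → r * a ν ≡ b ν mod m ν
crt-linear K m m-coprime a a⊥m b =
  let r , r≡c = crt K m m-coprime (proj₁ ∘ solution)
  in r , λ ν → trans (≡mod-*-congʳ (a ν) (r≡c ν)) (proj₂ (solution ν))
  where
  solution : ∀ ν → ∃ λ c → c * a ν ≡ b ν mod m ν
  solution ν = coprime⇒solvable (a⊥m ν) (b ν)

-- y / gcd y m, taken from the divisibility witness so that no NonZero (gcd y m) is needed.
cofactor : ℕ → ℕ → ℕ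
cofactor y m = _∣_.quotient (gcd[m,n]∣m y m)

y≡cofactor*gcd : ∀ y m → y ≡ cofactor y m * gcd y m
y≡cofactor*gcd y m = _∣_.equality (gcd[m,n]∣m y m)

cofactor-coprime : ∀ y .{{_ : NonZero m}} → gcd y m * d ≡ m → Coprime (cofactor y m) d
cofactor-coprime {m} {d} y gd≡m =
  GCD≡1⇒coprime (GCD-* {{g≢0}} (subst₂ (GCD _) m≡dg (sym (*-identityˡ g)) G))
  where
  g : ℕ
  g = gcd y m
  g≢0 : NonZero g
  g≢0 = m*n≢0⇒m≢0 g {{subst NonZero (sym gd≡m) it}}
  m≡dg : m ≡ d * g
  m≡dg = trans (sym gd≡m) (*-comm g d)
  G : GCD (cofactor y m * g) m g
  G = subst (λ t → GCD t m g) (y≡cofactor*gcd y m) (gcd-GCD y m)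

≡mod-lift : ∀ y y′ r .{{_ : NonZero m}} .{{_ : NonZero d}} →
            gcd y m * d ≡ m → gcd y′ m * d ≡ m →
            r * cofactor y m ≡ cofactor y′ m mod d → r * y ≡ y′ mod m
≡mod-lift {m} {d} y y′ r gd≡m g′d≡m ru≡u′ = begin
  r * y % m        ≡⟨ cong (λ t → r * t % m) (y≡cofactor*gcd y m) ⟩
  r * (u * g) % m  ≡⟨ cong (_% m) (*-assoc r u g) ⟨
  r * u * g % m    ≡⟨ ≡mod-*-scale g (trans (sym gd≡m) (*-comm g d)) ru≡u′ ⟩
  u′ * g % m       ≡⟨ cong (λ t → u′ * t % m) g′≡g ⟨
  u′ * g′ % m      ≡⟨ cong (_% m) (y≡cofactor*gcd y′ m) ⟨
  y′ % m           ∎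
  where
  open ≡-Reasoning
  g g′ u u′ : ℕ
  g = gcd y m
  g′ = gcd y′ m
  u = cofactor y m
  u′ = cofactor y′ m
  g′≡g : g′ ≡ g
  g′≡g = *-cancelʳ-≡ g′ g d (trans g′d≡m (sym gd≡m))

lemma3p6 : (K : ℕ) (p n : Fin K → ℕ)
           → (∀ ν → Prime (p ν))
           → (∀ ν μ → p ν ≡ p μ → ν ≡ μ)
           → (α : Fin K → ℕ) → (∀ ν → α ν ≥ 1)
           → (x x′ : Fin K → ℕ)
           → (∀ ν → x ν < modulus K p n)
           → (∀ ν → x′ ν < modulus K p n)
           → (∀ ν → gcd (x ν) (modulus K p n) * p ν ^ α ν ≡ modulus K p n)
           → (∀ ν → gcd (x′ ν) (modulus K p n) * p ν ^ α ν ≡ modulus K p n)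
           → Σ ℕ (λ r → (r < modulus K p n) × (gcd r (modulus K p n) ≡ 1)
               × (∀ ν → Σ ℕ (λ q → r * x ν ≡ x′ ν + q * modulus K p n)))
lemma3p6 K p n prime distinct α α≥1 x x′ x<M x′<M gx≡M gx′≡M =
  r , m%n<n r₀ M , coprime⇒gcd≡1 r⊥M , λ ν → ≡mod⇒∃quotient (rx≡x′ ν) (x′<M ν)
  where
  M : ℕ
  M = modulus K p n
  P : Fin K → ℕ
  P ν = p ν ^ α ν
  instance
    M≢0 : NonZero M
    M≢0 = modulus-nonZero K p n prime
    P≢0 : ∀ {ν} → NonZero (P ν)
    P≢0 {ν} = m^n≢0 (p ν) (α ν) {{prime⇒nonZero (prime ν)}}
  u u′ : Fin K → ℕ
  u ν = cofactor (x ν) M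
  u′ ν = cofactor (x′ ν) M
  solution : ∃ λ r₀ → ∀ ν → r₀ * u ν ≡ u′ ν mod P ν
  solution = crt-linear K P (prime-powers-coprime p α prime distinct)
                        u (λ ν → cofactor-coprime (x ν) (gx≡M ν)) u′
  r₀ r : ℕ
  r₀ = proj₁ solution
  r = r₀ % M
  r≡r₀ : ∀ ν → r ≡ r₀ mod P ν
  r≡r₀ ν = ≡mod-reduce (divides (gcd (x ν) M) (sym (gx≡M ν))) (%-≡mod r₀)
  ru≡u′ : ∀ ν → r * u ν ≡ u′ ν mod P ν
  ru≡u′ ν = trans (≡mod-*-congʳ {a = r} {b = r₀} (u ν) (r≡r₀ ν)) (proj₂ solution ν)
  rx≡x′ : ∀ ν → r * x ν ≡ x′ ν mod M
  rx≡x′ ν = ≡mod-lift (x ν) (x′ ν) r (gx≡M ν) (gx′≡M ν) (ru≡u′ ν)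
  r⊥M : Coprime r M
  r⊥M = coprime-modulus K p n λ ν →
    coprime-∣ʳ (coprime-factor (ru≡u′ ν) (cofactor-coprime (x′ ν) (gx′≡M ν))) (m∣m^n (α≥1 ν))
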